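{- For every finite alphabet $\Sigma$ and all positive integers $w,c$, the following relations are regular: (1) $\widetilde{\mathcal{R}}_{\in}(\Sigma,w,c)=\{(D,s_1,\dots,s_c): D\in\mathcal{B}(\Sigma,w)^{\circledast},\ s_1,\dots,s_c\in L(D)\}$; (2) $\widetilde{\mathcal{R}}(\Sigma,w,c)=\{(D,s_1,\dots,s_c): D\in\mathcal{B}(\Sigma,w,k),\ s_1,\dots,s_c\in\Sigma^{\le k},\ k\ge1\}$; (3) $\widetilde{\mathcal{R}}_{\notin}(\Sigma,w,c)=\{(D,s_1,\dots,s_c): D\in\mathcal{B}(\Sigma,w,k),\ s_1,\dots,s_c\in\Sigma^{\le k},\ s_i\notin L(D)\text{ for some }i\in[c],\ k\ge1\}$.
   Context: $\Sigma^{\le k}$ denotes the set of nonempty strings over $\Sigma$ of length at most $k$. Fix a padding symbol $\#$ not in any alphabet. A relation $R\subseteq\Gamma_1^+\times\cdots\times\Gamma_a^+$ is regular if $\{u_1\otimes\cdots\otimes u_a:(u_1,\dots,u_a)\in R\}$ is accepted by a finite automaton, where $u_1\otimes\cdots\otimes u_a$ is the string of length $\max_i|u_i|$ whose $j$-th symbol is the tuple of $j$-th symbols of the $u_i$, with $\#$ in place of missing symbols. ODDs. A $(\Sigma,w)$-layer is a tuple $B=(\ell,r,T,I,F,\iota,\phi)$ with $\ell,r\subseteq\{0,\dots,w-1\}$, $T\subseteq\ell\times(\Sigma\sqcup\{\#\})\times r$, $I\subseteq\ell$, $F\subseteq r$, Booleans $\iota,\phi$, $I=\emptyset$ if $\iota$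 is false and $F=\emptyset$ if $\phi$ is false; $\mathcal{B}(\Sigma,w)$ is the set of all such layers, an alphabet. A $(\Sigma,w)$-ODD of length $k$ is a string $B_1\cdots B_k$ over $\mathcal{B}(\Sigma,w)$ with $\ell(B_{i+1})=r(B_i)$, $\iota(B_i)$ true iff $i=1$, $\phi(B_i)$ true iff $i=k$; $\mathcal{B}(\Sigma,w,k)$ is the set of those of length $k$ and $\mathcal{B}(\Sigma,w)^{\circledast}=\bigcup_{k\ge1}\mathcal{B}(\Sigma,w,k)$. A nonempty string $\sigma_1\cdots\sigma_{k'}$ over $\Sigma$ with $k'\le k$ is accepted by $D$ if, setting $\hat\sigma_i=\sigma_i$ for $i\le k'$ and $\hat\sigma_i=\#$ otherwise, there are transitions $(p_i,\hat\sigma_i,q_i)\in T(B_i)$ with $p_{i+1}=q_i$, $p_1\in I(B_1)$, $q_k\in F(B_k)$; $L(D)$ is the set of accepted strings. -}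

module Defs where

open import Data.Nat using (ℕ; zero; suc; _≤_; _⊔_)
open import Data.Bool using (Bool; true; false)
open import Data.Fin using (Fin; toℕ; inject₁) renaming (zero to fzero; suc to fsuc)
open import Data.Fin.Subset using (Subset; _∈_; _⊆_) renaming (⊥ to ∅)
open import Data.Maybe using (Maybe; just; nothing)
open import Data.List using (List; []; _∷_; length; map; upTo; lookup)
open import Data.Vec using (Vec) renaming (map to vmap; lookup to vlookup)
open import Data.Vec.Relation.Unary.All using (All)
open import Data.Product using (Σ; ∃; _×_)
open import Relation.Binary.PropositionalEquality using (_≡_)
open import Relation.Nullary using (¬_)
open import Function.Bundles using (_⇔_)

-- Strings over an alphabet A are lists; padding symbol # is `nothing`
-- in `Maybe A`.

padAt : {A : Set} → List A → ℕ → Maybe A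
padAt []       _       = nothing
padAt (x ∷ xs) zero    = just x
padAt (x ∷ xs) (suc j) = padAt xs j

record DFA (A : Set) : Set where
  field
    states : ℕ
    start  : Fin states
    δ      : Fin states → A → Fin states
    final  : Fin states → Bool

run : {A : Set} (M : DFA A) → Fin (DFA.states M) → List A → Fin (DFA.states M)
run M q []       = q
run M q (a ∷ as) = run M (DFA.δ M q a) as

acceptsDFA : {A : Set} → DFA A → List A → Bool
acceptsDFA M u = DFA.final M (run M (DFA.start M) u)

RegularLanguage : {A : Set} → (List A → Set) → Set
RegularLanguage {A} L = Σ (DFA A) λ M → ∀ u → (acceptsDFA M u ≡ true) ⇔ L u

maxLen : {B : Set} {c : ℕ} → Vec (List B) c → ℕ
maxLen Vec.[]       = 0
maxLen (s Vec.∷ ss) = length s ⊔ maxLen ss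

conv : {A B : Set} {c : ℕ} → List A → Vec (List B) c → List (Maybe A × Vec (Maybe B) c)
conv u ss = map (λ j → padAt u j Data.Product., vmap (λ s → padAt s j) ss)
                (upTo (length u ⊔ maxLen ss))

RegularRelation : {A B : Set} {c : ℕ} → (List A → Vec (List B) c → Set) → Set
RegularRelation {A} {B} {c} R =
  RegularLanguage {Maybe A × Vec (Maybe B) c}
    (λ u → ∃ λ D → ∃ λ ss → R D ss × conv D ss ≡ u)

-- Layers. Alphabet Σ = Fin n; padded alphabet Σ ⊔ {#} = Maybe (Fin n);
-- states {0,…,w-1} = Fin w.  T is given by its characteristic function.

record Layer (n w : ℕ) : Set where
  field
    ℓ r  : Subset w
    T    : Fin w → Maybe (Fin n) → Fin w → Bool
    I F  : Subset w
    ι φ  : Bool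
    T⊆   : ∀ p a q → T p a q ≡ true → (p ∈ ℓ) × (q ∈ r)
    I⊆ℓ  : I ⊆ ℓ
    F⊆r  : F ⊆ r
    ¬ι⇒I : ι ≡ false → I ≡ ∅
    ¬φ⇒F : φ ≡ false → F ≡ ∅

open Layer public

-- D = B₁⋯B_k is an ODD (of length k = length D ≥ 1); indices 0-based.
IsODD : {n w : ℕ} → List (Layer n w) → Set
IsODD D =
  (1 ≤ length D)
  × (∀ (i j : Fin (length D)) → suc (toℕ i) ≡ toℕ j → ℓ (lookup D j) ≡ r (lookup D i))
  × (∀ (i : Fin (length D)) → (ι (lookup D i) ≡ true) ⇔ (toℕ i ≡ 0))
  × (∀ (i : Fin (length D)) → (φ (lookup D i) ≡ true) ⇔ (suc (toℕ i) ≡ length D))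

Accepts : {n w : ℕ} → List (Layer n w) → List (Fin n) → Set
Accepts {n} {w} D s =
  (1 ≤ length s) × (length s ≤ length D)
  × Σ (Fin (suc (length D)) → Fin w) λ p →
      (∀ (i : Fin (length D)) →
         T (lookup D i) (p (inject₁ i)) (padAt s (toℕ i)) (p (fsuc i)) ≡ true)
    × (∀ (i : Fin (length D)) → toℕ i ≡ 0 → p (inject₁ i) ∈ I (lookup D i))
    × (∀ (i : Fin (length D)) → suc (toℕ i) ≡ length D → p (fsuc i) ∈ F (lookup D i))

InΣ≤ : {n : ℕ} → ℕ → List (Fin n) → Set
InΣ≤ k s = (1 ≤ length s) × (length s ≤ k)

R∈ : (n w c : ℕ) → List (Layer n w) → Vec (List (Fin n)) c → Set
R∈ n w c D ss = IsODD D × All (Accepts D) ss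

R~ : (n w c : ℕ) → List (Layer n w) → Vec (List (Fin n)) c → Set
R~ n w c D ss = IsODD D × All (InΣ≤ (length D)) ss

R∉ : (n w c : ℕ) → List (Layer n w) → Vec (List (Fin n)) c → Set
R∉ n w c D ss = IsODD D × All (InΣ≤ (length D)) ss
                × ∃ λ (i : Fin c) → ¬ Accepts D (vlookup ss i)

module Submission where

-- A single deterministic automaton reads the convolution D ⊗ s₁ ⊗ ⋯ ⊗ s_c; it is a product of
-- finitely many finite-state machines.  On the layer track it checks the ODD conditions layer by
-- layer, remembering only the right state set of the last layer, which the left state set of the
-- next one must equal.  On each string track it checks the shape σ⁺#* (so sᵢ is nonempty, and
-- |sᵢ| ≤ k since the layer track, having no #, is as long as the convolution), and it runs the
-- subset construction of D: the set of states reachable through the layers read so far.  The three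
-- relations then differ only in their accepting states: the shape checks alone, together with
-- "every reachable set is nonempty", or together with "some reachable set is empty".

open import Defs
open import Data.Bool using (Bool; true; false; if_then_else_)
open import Data.Bool.Properties using (not-¬; ¬-not) renaming (_≟_ to _≟ᵇ_)
open import Data.Empty using (⊥; ⊥-elim)
open import Data.Fin using (Fin; toℕ; inject₁; combine; remQuot) renaming (zero to fzero; suc to fsuc)
open import Data.Fin.Properties using (remQuot-combine; 2↔Bool; ∀-cons; any?; all?)
open import Data.Fin.Subset using (Subset; _∈_; Nonempty) renaming (⊤ to full)
open import Data.Fin.Subset.Properties using (_∈?_; nonempty?; ∈⊤)
open import Data.List using (List; []; _∷_; foldl; map; length; lookup; applyUpTo)
open import Data.List.Properties
  using (foldl-map; map-∘; length-map; length-applyUpTo; map-applyUpTo; map-upTo)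
  using (∷-injective; ∷-injectiveˡ; ∷-injectiveʳ)
open import Data.Maybe using (Maybe; just; nothing)
open import Data.Nat using (ℕ; zero; suc; _*_; _≤_; s≤s; z≤n)
open import Data.Nat.Properties using (suc-injective; ⊔-lub; m≥n⇒m⊔n≡m)
open import Data.Product as Product using (_×_; ∃; _,_; proj₁; proj₂; uncurry)
open import Data.Unit using (⊤; tt)
open import Data.Vec as Vec using (Vec; tabulate; replicate; uncons)
  renaming ([] to []ᵛ; _∷_ to _∷ᵛ_; lookup to lookupᵛ)
open import Data.Vec.Functional using () renaming (_∷_ to _∷ᶠ_)
open import Data.Vec.Properties
  using (lookup∘tabulate; lookup-replicate; lookup-map; tabulate∘lookup; tabulate-cong; tabulate-∘)
  using (≡-dec; []=⇒lookup; lookup⇒[]=)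
open import Data.Vec.Relation.Unary.All.Properties using (lookup⁺; lookup⁻)
open import Function using (_∘_; id; case_of_)
open import Function.Bundles using (_⇔_; mk⇔; Inverse; Equivalence)
open import Function.Properties.Equivalence using () renaming (trans to ⇔-trans; sym to ⇔-sym)
open import Level using (0ℓ)
open import Relation.Binary.PropositionalEquality
open import Relation.Nullary using (Dec; yes; no; does; ¬_)
open import Relation.Nullary.Decidable using (_×-dec_; _→-dec_; ¬?)
open import Relation.Unary using (Pred; Decidable)

open Equivalence using (to; from)

-- A retract of some Fin N, which is all a DFA needs to number its states.
record Finite (S : Set) : Set where
  field
    size          : ℕ
    index         : S → Fin size
    element       : Fin size → S
    element-index : ∀ s → element (index s) ≡ s

open Finite

Fin-finite : ∀ k → Finite (Fin k)
Fin-finite k = record { size = k ; index = id ; element = id ; element-index = λ _ → refl }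

retract-finite : {S T : Set} → Finite T → (f : S → T) (g : T → S) → (∀ s → g (f s) ≡ s) → Finite S
retract-finite T-fin f g g∘f = record
  { size          = size T-fin
  ; index         = index T-fin ∘ f
  ; element       = g ∘ element T-fin
  ; element-index = λ s → trans (cong g (element-index T-fin (f s))) (g∘f s)
  }

×-finite : {S T : Set} → Finite S → Finite T → Finite (S × T)
×-finite S-fin T-fin = record
  { size          = size S-fin * size T-fin
  ; index         = λ (s , t) → combine (index S-fin s) (index T-fin t)
  ; element       = elements ∘ remQuot (size T-fin)
  ; element-index = λ (s , t) → begin
      elements (remQuot (size T-fin) (combine (index S-fin s) (index T-fin t)))
        ≡⟨ cong elements (remQuot-combine (index S-fin s) (index T-fin t)) ⟩
      (element S-fin (index S-fin s) , element T-fin (index T-fin t))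
        ≡⟨ cong₂ _,_ (element-index S-fin s) (element-index T-fin t) ⟩
      (s , t) ∎
  }
  where
  open ≡-Reasoning
  elements = Product.map (element S-fin) (element T-fin)

Maybe-finite : {S : Set} → Finite S → Finite (Maybe S)
Maybe-finite {S} S-fin = record { size = suc (size S-fin) ; index = idx ; element = elt ; element-index = elt-idx }
  where
  idx : Maybe S → Fin (suc (size S-fin))
  idx nothing  = fzero
  idx (just s) = fsuc (index S-fin s)
  elt : Fin (suc (size S-fin)) → Maybe S
  elt fzero    = nothing
  elt (fsuc i) = just (element S-fin i)
  elt-idx : ∀ s → elt (idx s) ≡ s
  elt-idx nothing  = refl
  elt-idx (just s) = cong just (element-index S-fin s)

Bool-finite : Finite Bool
Bool-finite = retract-finite (Fin-finite 2) (Inverse.from 2↔Bool) (Inverse.to 2↔Bool) (Inverse.strictlyInverseˡ 2↔Bool)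

Vec-finite : {S : Set} → Finite S → ∀ c → Finite (Vec S c)
Vec-finite S-fin zero    = retract-finite (Fin-finite 1) (λ _ → fzero) (λ _ → []ᵛ) λ { []ᵛ → refl }
Vec-finite S-fin (suc c) =
  retract-finite (×-finite S-fin (Vec-finite S-fin c)) uncons (uncurry _∷ᵛ_) λ { (_ ∷ᵛ _) → refl }

does⇔ : {P : Set} (P? : Dec P) → (does P? ≡ true) ⇔ P
does⇔ (yes p) = mk⇔ (λ _ → p) (λ _ → refl)
does⇔ (no ¬p) = mk⇔ (λ ()) (λ p → ⊥-elim (¬p p))

Π-⇔ : {I : Set} {P Q : I → Set} → (∀ i → P i ⇔ Q i) → (∀ i → P i) ⇔ (∀ i → Q i)
Π-⇔ P⇔Q = mk⇔ (λ p i → to (P⇔Q i) (p i)) (λ q i → from (P⇔Q i) (q i))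

∃¬-⇔ : {I : Set} {P Q : I → Set} → (∀ i → P i ⇔ Q i) → (∃ λ i → ¬ P i) ⇔ (∃ λ i → ¬ Q i)
∃¬-⇔ P⇔Q = mk⇔ (λ (i , ¬p) → i , ¬p ∘ from (P⇔Q i)) (λ (i , ¬q) → i , ¬q ∘ to (P⇔Q i))

subsetOf : {w : ℕ} {P : Pred (Fin w) 0ℓ} → Decidable P → Subset w
subsetOf P? = tabulate (does ∘ P?)

∈-subsetOf : {w : ℕ} {P : Pred (Fin w) 0ℓ} (P? : Decidable P) (q : Fin w) → q ∈ subsetOf P? ⇔ P q
∈-subsetOf P? q = mk⇔
  (λ q∈ → to (does⇔ (P? q)) (trans (sym (lookup∘tabulate (does ∘ P?) q)) ([]=⇒lookup q∈)))
  (λ Pq → lookup⇒[]= q _ (trans (lookup∘tabulate (does ∘ P?) q) (from (does⇔ (P? q)) Pq)))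

record Machine (A : Set) : Set₁ where
  field
    State  : Set
    finite : Finite State
    start  : State
    step   : State → A → State

  execFrom : State → List A → State
  execFrom = foldl step

  exec : List A → State
  exec = execFrom start

open Machine

module _ {A : Set} (M : Machine A) where
  private
    M-fin = finite M

  toDFA : (State M → Bool) → DFA A
  toDFA accept = record
    { states = size M-fin
    ; start  = index M-fin (start M)
    ; δ      = λ q a → index M-fin (step M (element M-fin q) a)
    ; final  = accept ∘ element M-fin
    }

  run-toDFA : ∀ accept s u → run (toDFA accept) (index M-fin s) u ≡ index M-fin (execFrom M s u)
  run-toDFA accept s []      = refl
  run-toDFA accept s (a ∷ u) rewrite element-index M-fin s = run-toDFA accept (step M s a) u

  machine⇒regular : {Acc : Pred (State M) 0ℓ} → Decidable Acc → {P : List A → Set} →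
                    (∀ u → Acc (exec M u) ⇔ P u) → RegularLanguage P
  machine⇒regular Acc? Acc⇔P = toDFA (does ∘ Acc?) , accepts⇔
    where
    accepts⇔ : ∀ u → (acceptsDFA (toDFA (does ∘ Acc?)) u ≡ true) ⇔ _
    accepts⇔ u rewrite run-toDFA (does ∘ Acc?) (start M) u | element-index M-fin (exec M u) =
      ⇔-trans (does⇔ (Acc? (exec M u))) (Acc⇔P u)

_⊗_ : {A : Set} → Machine A → Machine A → Machine A
M ⊗ N = record
  { State  = State M × State N
  ; finite = ×-finite (finite M) (finite N)
  ; start  = start M , start N
  ; step   = λ (s , t) a → step M s a , step N t a
  }

execFrom-⊗ : {A : Set} (M N : Machine A) →
             ∀ s t u → execFrom (M ⊗ N) (s , t) u ≡ (execFrom M s u , execFrom N t u)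
execFrom-⊗ M N s t []      = refl
execFrom-⊗ M N s t (a ∷ u) = execFrom-⊗ M N (step M s a) (step N t a) u

exec-⊗ : {A : Set} (M N : Machine A) → ∀ u → exec (M ⊗ N) u ≡ (exec M u , exec N u)
exec-⊗ M N = execFrom-⊗ M N (start M) (start N)

comap : {A B : Set} → (A → B) → Machine B → Machine A
comap f M = record { State = State M ; finite = finite M ; start = start M ; step = λ s a → step M s (f a) }

execFrom-comap : {A B : Set} (f : A → B) (M : Machine B) →
                 ∀ s u → execFrom (comap f M) s u ≡ execFrom M s (map f u)
execFrom-comap f M s u = sym (foldl-map (step M) f s u)

parallel : {A B : Set} (c : ℕ) → (Fin c → A → B) → Machine B → Machine A
parallel c π M = record
  { State  = Vec (State M) c
  ; finite = Vec-finite (finite M) c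
  ; start  = replicate c (start M)
  ; step   = λ ss a → tabulate (λ k → step M (lookupᵛ ss k) (π k a))
  }

lookup-execFrom-parallel : {A B : Set} {c : ℕ} (π : Fin c → A → B) (M : Machine B) →
  ∀ ss u k → lookupᵛ (execFrom (parallel c π M) ss u) k ≡ execFrom M (lookupᵛ ss k) (map (π k) u)
lookup-execFrom-parallel π M ss []      k = refl
lookup-execFrom-parallel π M ss (a ∷ u) k =
  trans (lookup-execFrom-parallel π M _ u k) (cong (λ s → execFrom M s (map (π k) u)) (lookup∘tabulate _ k))

lookup-exec-parallel : {A B : Set} {c : ℕ} (π : Fin c → A → B) (M : Machine B) →
  ∀ u k → lookupᵛ (exec (parallel c π M) u) k ≡ exec M (map (π k) u)
lookup-exec-parallel π M u k =
  trans (lookup-execFrom-parallel π M _ u k) (cong (λ s → execFrom M s (map (π k) u)) (lookup-replicate k (start M)))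

-- Checking the layer track

module _ {n w : ℕ} where

  data Phase : Set where
    initial  : Phase
    expect   : Subset w → Phase
    complete : Phase
    failed   : Phase

  Phase-finite : Finite Phase
  Phase-finite =
    retract-finite (Maybe-finite (Maybe-finite (Maybe-finite (Vec-finite Bool-finite w)))) code decode decode-code
    where
    code : Phase → Maybe (Maybe (Maybe (Subset w)))
    code failed     = nothing
    code initial    = just nothing
    code complete   = just (just nothing)
    code (expect R) = just (just (just R))
    decode : Maybe (Maybe (Maybe (Subset w))) → Phase
    decode nothing                = failed
    decode (just nothing)         = initial
    decode (just (just nothing))  = complete
    decode (just (just (just R))) = expect R
    decode-code : ∀ q → decode (code q) ≡ q
    decode-code initial    = refl
    decode-code (expect R) = refl
    decode-code complete   = refl
    decode-code failed     = refl

  Admissible : Phase → Layer n w → Set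
  Admissible initial    B = ι B ≡ true
  Admissible (expect R) B = ι B ≡ false × ℓ B ≡ R
  Admissible complete   B = ⊥
  Admissible failed     B = ⊥

  admissible? : ∀ q B → Dec (Admissible q B)
  admissible? initial    B = ι B ≟ᵇ true
  admissible? (expect R) B = ι B ≟ᵇ false ×-dec ≡-dec _≟ᵇ_ (ℓ B) R
  admissible? complete   B = no λ ()
  admissible? failed     B = no λ ()

  next : Layer n w → Phase
  next B = if φ B then complete else expect (r B)

  phaseStep : Phase → Maybe (Layer n w) → Phase
  phaseStep q nothing  = failed
  phaseStep q (just B) = if does (admissible? q B) then next B else failed

  oddChecker : Machine (Maybe (Layer n w))
  oddChecker = record { State = Phase ; finite = Phase-finite ; start = initial ; step = phaseStep }

  data IsComplete : Phase → Set where
    complete : IsComplete complete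

  isComplete? : Decidable IsComplete
  isComplete? complete   = yes complete
  isComplete? initial    = no λ ()
  isComplete? (expect R) = no λ ()
  isComplete? failed     = no λ ()

  Completes : Phase → List (Layer n w) → Set
  Completes q []       = IsComplete q
  Completes q (B ∷ Bs) = Admissible q B × Completes (next B) Bs

  execFrom-failed : ∀ u → execFrom oddChecker failed u ≡ failed
  execFrom-failed []            = refl
  execFrom-failed (nothing ∷ u) = execFrom-failed u
  execFrom-failed (just _ ∷ u)  = execFrom-failed u

  complete⇔completes : ∀ q u → IsComplete (execFrom oddChecker q u) ⇔ ∃ λ D → u ≡ map just D × Completes q D
  complete⇔completes q [] = mk⇔ (λ c → [] , refl , c) λ { ([] , _ , c) → c ; (_ ∷ _ , () , _) }
  complete⇔completes q (nothing ∷ u) rewrite execFrom-failed u =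
    mk⇔ (λ ()) λ { ([] , () , _) ; (_ ∷ _ , () , _) }
  complete⇔completes q (just B ∷ u) with admissible? q B
  ... | yes a = mk⇔
    (λ c → let (D , u≡D , cs) = to (complete⇔completes (next B) u) c in B ∷ D , cong (just B ∷_) u≡D , a , cs)
    λ { ([] , () , _)
      ; (_ ∷ D , e , _ , cs) → case ∷-injective e of λ
          { (refl , u≡D) → from (complete⇔completes (next B) u) (D , u≡D , cs) } }
  ... | no ¬a rewrite execFrom-failed u = mk⇔ (λ ())
    λ { ([] , () , _)
      ; (_ ∷ D , e , a , _) → case ∷-injective e of λ { (refl , _) → ⊥-elim (¬a a) } }

  Chained : List (Layer n w) → Set
  Chained D = ∀ (i j : Fin (length D)) → suc (toℕ i) ≡ toℕ j → ℓ (lookup D j) ≡ r (lookup D i)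

  InitialAtHead : List (Layer n w) → Set
  InitialAtHead D = ∀ (i : Fin (length D)) → (ι (lookup D i) ≡ true) ⇔ (toℕ i ≡ 0)

  FinalAtLast : List (Layer n w) → Set
  FinalAtLast D = ∀ (i : Fin (length D)) → (φ (lookup D i) ≡ true) ⇔ (suc (toℕ i) ≡ length D)

  chained-[_] : ∀ B → Chained (B ∷ [])
  chained-[ B ] fzero fzero ()

  chained-∷∷ : ∀ B B′ Bs → Chained (B ∷ B′ ∷ Bs) ⇔ (ℓ B′ ≡ r B × Chained (B′ ∷ Bs))
  chained-∷∷ B B′ Bs =
    mk⇔ (λ ch → ch fzero (fsuc fzero) refl , λ i j e → ch (fsuc i) (fsuc j) (cong suc e)) linked
    where
    linked : ℓ B′ ≡ r B × Chained (B′ ∷ Bs) → Chained (B ∷ B′ ∷ Bs)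
    linked (ℓ≡r , ch) fzero    (fsuc fzero)    _ = ℓ≡r
    linked (ℓ≡r , ch) (fsuc i) (fsuc j)        e = ch i j (suc-injective e)
    linked _          fzero    fzero           ()
    linked _          fzero    (fsuc (fsuc _)) ()
    linked _          (fsuc _) fzero           ()

  initialAtHead-∷ : ∀ B Bs → InitialAtHead (B ∷ Bs) ⇔ (ι B ≡ true × ∀ i → ι (lookup Bs i) ≡ false)
  initialAtHead-∷ B Bs = mk⇔
    (λ ini → from (ini fzero) refl , λ i → ¬-not λ ι≡true → case to (ini (fsuc i)) ι≡true of λ ())
    headOnly
    where
    headOnly : ι B ≡ true × (∀ i → ι (lookup Bs i) ≡ false) → InitialAtHead (B ∷ Bs)
    headOnly (ι₀ , ιs) fzero    = mk⇔ (λ _ → refl) (λ _ → ι₀)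
    headOnly (ι₀ , ιs) (fsuc i) = mk⇔ (λ ι≡true → ⊥-elim (not-¬ (ιs i) ι≡true)) λ ()

  finalAtLast-[_] : ∀ B → FinalAtLast (B ∷ []) ⇔ (φ B ≡ true)
  finalAtLast-[ B ] =
    mk⇔ (λ fin → from (fin fzero) refl) λ { φ≡true fzero → mk⇔ (λ _ → refl) (λ _ → φ≡true) }

  finalAtLast-∷∷ : ∀ B B′ Bs → FinalAtLast (B ∷ B′ ∷ Bs) ⇔ (φ B ≡ false × FinalAtLast (B′ ∷ Bs))
  finalAtLast-∷∷ B B′ Bs = mk⇔
    (λ fin → ¬-not (λ φ≡true → case to (fin fzero) φ≡true of λ ())
           , λ i → mk⇔ (suc-injective ∘ to (fin (fsuc i))) (from (fin (fsuc i)) ∘ cong suc))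
    lastOnly
    where
    lastOnly : φ B ≡ false × FinalAtLast (B′ ∷ Bs) → FinalAtLast (B ∷ B′ ∷ Bs)
    lastOnly (φ₀ , fin) fzero    = mk⇔ (λ φ≡true → ⊥-elim (not-¬ φ₀ φ≡true)) λ ()
    lastOnly (φ₀ , fin) (fsuc i) = mk⇔ (cong suc ∘ to (fin i)) (from (fin i) ∘ suc-injective)

  completes-next : ∀ B Bs → Completes (next B) Bs ⇔
    ((∀ i → ι (lookup Bs i) ≡ false) × Chained (B ∷ Bs) × FinalAtLast (B ∷ Bs))
  completes-next B [] with φ B in φ≡
  ... | true  = mk⇔ (λ _ → (λ ()) , chained-[ B ] , from finalAtLast-[ B ] φ≡) (λ _ → complete)
  ... | false = mk⇔ (λ ()) λ (_ , _ , fin) → ⊥-elim (not-¬ φ≡ (to finalAtLast-[ B ] fin))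
  completes-next B (B′ ∷ Bs) with φ B in φ≡
  ... | true  = mk⇔ (λ ()) λ (_ , _ , fin) → ⊥-elim (not-¬ (proj₁ (to (finalAtLast-∷∷ B B′ Bs) fin)) φ≡)
  ... | false = mk⇔
    (λ ((ι′ , ℓ≡r) , cs) → let (ιs , ch , fin) = to (completes-next B′ Bs) cs in
       ∀-cons ι′ ιs , from (chained-∷∷ B B′ Bs) (ℓ≡r , ch) , from (finalAtLast-∷∷ B B′ Bs) (φ≡ , fin))
    (λ (ιs , ch , fin) → let (ℓ≡r , ch′) = to (chained-∷∷ B B′ Bs) ch in
       (ιs fzero , ℓ≡r) ,
       from (completes-next B′ Bs) (ιs ∘ fsuc , ch′ , proj₂ (to (finalAtLast-∷∷ B B′ Bs) fin)))

  isODD⇔completes : ∀ D → IsODD D ⇔ Completes initial D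
  isODD⇔completes []       = mk⇔ (λ { (() , _) }) λ ()
  isODD⇔completes (B ∷ Bs) = mk⇔
    (λ (_ , ch , ini , fin) → let (ι₀ , ιs) = to (initialAtHead-∷ B Bs) ini in
       ι₀ , from (completes-next B Bs) (ιs , ch , fin))
    (λ (ι₀ , cs) → let (ιs , ch , fin) = to (completes-next B Bs) cs in
       s≤s z≤n , ch , from (initialAtHead-∷ B Bs) (ι₀ , ιs) , fin)

-- Checking the shape of a string track

pad : {A : Set} → List A → ℕ → List (Maybe A)
pad s = applyUpTo (padAt s)

pad-length : {A : Set} (D : List A) → pad D (length D) ≡ map just D
pad-length []      = refl
pad-length (x ∷ D) = cong (just x ∷_) (pad-length D)

Padded : {A : Set} → ℕ → List (Maybe A) → Set
Padded {A} m xs = ∃ λ (s : List A) → (1 ≤ length s × length s ≤ m) × xs ≡ pad s m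

data Scan : Set where
  atStart inWord inPadding broken : Scan

Scan-finite : Finite Scan
Scan-finite = retract-finite (Fin-finite 4) code decode decode-code
  where
  code : Scan → Fin 4
  code atStart   = fzero
  code inWord    = fsuc fzero
  code inPadding = fsuc (fsuc fzero)
  code broken    = fsuc (fsuc (fsuc fzero))
  decode : Fin 4 → Scan
  decode fzero                  = atStart
  decode (fsuc fzero)           = inWord
  decode (fsuc (fsuc fzero))    = inPadding
  decode (fsuc (fsuc (fsuc _))) = broken
  decode-code : ∀ q → decode (code q) ≡ q
  decode-code atStart   = refl
  decode-code inWord    = refl
  decode-code inPadding = refl
  decode-code broken    = refl

scanStep : {A : Set} → Scan → Maybe A → Scan
scanStep atStart   (just _) = inWord
scanStep inWord    (just _) = inWord
scanStep inWord    nothing  = inPadding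
scanStep inPadding nothing  = inPadding
scanStep atStart   nothing  = broken
scanStep inPadding (just _) = broken
scanStep broken    _        = broken

paddingChecker : {A : Set} → Machine (Maybe A)
paddingChecker = record { State = Scan ; finite = Scan-finite ; start = atStart ; step = scanStep }

data Accepting : Scan → Set where
  inWord    : Accepting inWord
  inPadding : Accepting inPadding

accepting? : Decidable Accepting
accepting? atStart   = no λ ()
accepting? inWord    = yes inWord
accepting? inPadding = yes inPadding
accepting? broken    = no λ ()

module _ {A : Set} where
  private
    scan : Scan → List (Maybe A) → Scan
    scan = execFrom paddingChecker

  scan-broken : ∀ xs → scan broken xs ≡ broken
  scan-broken []       = refl
  scan-broken (_ ∷ xs) = scan-broken xs

  accepting-inPadding : ∀ xs → Accepting (scan inPadding xs) ⇔ xs ≡ pad [] (length xs)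
  accepting-inPadding []             = mk⇔ (λ _ → refl) (λ _ → inPadding)
  accepting-inPadding (nothing ∷ xs) =
    mk⇔ (cong (nothing ∷_) ∘ to (accepting-inPadding xs)) (from (accepting-inPadding xs) ∘ ∷-injectiveʳ)
  accepting-inPadding (just _ ∷ xs) rewrite scan-broken xs = mk⇔ (λ ()) λ ()

  accepting-inWord : ∀ xs → Accepting (scan inWord xs) ⇔
                     ∃ λ (s : List A) → length s ≤ length xs × xs ≡ pad s (length xs)
  accepting-inWord []             = mk⇔ (λ _ → [] , z≤n , refl) (λ _ → inWord)
  accepting-inWord (nothing ∷ xs) = mk⇔
    (λ acc → [] , z≤n , to (accepting-inPadding (nothing ∷ xs)) acc)
    λ { ([] , _ , e) → from (accepting-inPadding (nothing ∷ xs)) e ; (_ ∷ _ , _ , ()) }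
  accepting-inWord (just a ∷ xs)  = mk⇔
    (λ acc → let (s , s≤ , e) = to (accepting-inWord xs) acc in a ∷ s , s≤s s≤ , cong (just a ∷_) e)
    λ { ([] , _ , ()) ; (_ ∷ s , s≤s s≤ , e) → from (accepting-inWord xs) (s , s≤ , ∷-injectiveʳ e) }

  accepting⇔padded : ∀ xs → Accepting (scan atStart xs) ⇔ Padded (length xs) xs
  accepting⇔padded []             = mk⇔ (λ ()) λ { ([] , (() , _) , _) ; (_ ∷ _ , (_ , ()) , _) }
  accepting⇔padded (nothing ∷ xs) rewrite scan-broken xs =
    mk⇔ (λ ()) λ { ([] , (() , _) , _) ; (_ ∷ _ , _ , ()) }
  accepting⇔padded (just a ∷ xs)  = mk⇔
    (λ acc → let (s , s≤ , e) = to (accepting-inWord xs) acc in a ∷ s , (s≤s z≤n , s≤s s≤) , cong (just a ∷_) e)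
    λ { ([] , (() , _) , _) ; (_ ∷ s , (_ , s≤s s≤) , e) → from (accepting-inWord xs) (s , s≤ , ∷-injectiveʳ e) }

-- Subset construction along a string track

module _ {n w : ℕ} where

  Track : Set
  Track = Maybe (Layer n w) × Maybe (Fin n)

  Successor : Subset w → Layer n w → Maybe (Fin n) → Fin w → Set
  Successor S B a q =
    (φ B ≡ true → q ∈ F B) × ∃ λ p → p ∈ S × (ι B ≡ true → p ∈ I B) × T B p a q ≡ true

  successor? : ∀ S B a → Decidable (Successor S B a)
  successor? S B a q = (φ B ≟ᵇ true →-dec q ∈? F B) ×-dec any? λ p →
    p ∈? S ×-dec (ι B ≟ᵇ true →-dec p ∈? I B) ×-dec T B p a q ≟ᵇ true

  -- A missing layer never occurs once the layer track is an ODD; it is skipped.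
  reachStep : Subset w → Track → Subset w
  reachStep S (nothing , a) = S
  reachStep S (just B , a)  = subsetOf (successor? S B a)

  reachability : Machine Track
  reachability = record { State = Subset w ; finite = Vec-finite Bool-finite w ; start = full ; step = reachStep }

  Path : Fin w → List Track → Set
  Path p []                   = ⊤
  Path p ((nothing , a) ∷ ys) = Path p ys
  Path p ((just B , a) ∷ ys)  =
    (ι B ≡ true → p ∈ I B) × ∃ λ q → T B p a q ≡ true × (φ B ≡ true → q ∈ F B) × Path q ys

  nonempty⇔path : ∀ S ys → Nonempty (execFrom reachability S ys) ⇔ ∃ λ p → p ∈ S × Path p ys
  nonempty⇔path S [] = mk⇔ (λ (p , p∈S) → p , p∈S , tt) (λ (p , p∈S , _) → p , p∈S)
  nonempty⇔path S ((nothing , a) ∷ ys) = nonempty⇔path S ys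
  nonempty⇔path S ((just B , a) ∷ ys) = mk⇔
    (λ ne → let (q , q∈ , path) = to (nonempty⇔path S′ ys) ne
                (φ→F , p , p∈S , ι→I , t) = to (∈-subsetOf (successor? S B a) q) q∈
            in p , p∈S , ι→I , q , t , φ→F , path)
    (λ (p , p∈S , ι→I , q , t , φ→F , path) →
       from (nonempty⇔path S′ ys) (q , from (∈-subsetOf (successor? S B a) q) (φ→F , p , p∈S , ι→I , t) , path))
    where S′ = subsetOf (successor? S B a)

  pairs : List (Layer n w) → (ℕ → Maybe (Fin n)) → List Track
  pairs D σ = applyUpTo (λ j → padAt D j , σ j) (length D)

  -- The run condition of Accepts, with the first and last position recognised by the flags ι and φ
  -- instead of by their index, as a left-to-right reader sees them.
  IsRun : (D : List (Layer n w)) → (ℕ → Maybe (Fin n)) → (Fin (suc (length D)) → Fin w) → Set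
  IsRun D σ P =
      (∀ i → T (lookup D i) (P (inject₁ i)) (σ (toℕ i)) (P (fsuc i)) ≡ true)
    × (∀ i → ι (lookup D i) ≡ true → P (inject₁ i) ∈ I (lookup D i))
    × (∀ i → φ (lookup D i) ≡ true → P (fsuc i) ∈ F (lookup D i))

  isRun⇔path : ∀ D σ p → (∃ λ P → P fzero ≡ p × IsRun D σ P) ⇔ Path p (pairs D σ)
  isRun⇔path []       σ p = mk⇔ (λ _ → tt) (λ _ → (λ _ → p) , refl , (λ ()) , (λ ()) , (λ ()))
  isRun⇔path (B ∷ Bs) σ p = mk⇔
    (λ { (P , refl , t , ι→I , φ→F) → ι→I fzero , P (fsuc fzero) , t fzero , φ→F fzero ,
           to (isRun⇔path Bs (σ ∘ suc) _) (P ∘ fsuc , refl , t ∘ fsuc , ι→I ∘ fsuc , φ→F ∘ fsuc) })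
    (λ (ι→I , q , t , φ→F , path) → extend ι→I t φ→F (from (isRun⇔path Bs (σ ∘ suc) q) path))
    where
    extend : ∀ {q} → (ι B ≡ true → p ∈ I B) → T B p (σ 0) q ≡ true → (φ B ≡ true → q ∈ F B) →
             (∃ λ P → P fzero ≡ q × IsRun Bs (σ ∘ suc) P) → ∃ λ P → P fzero ≡ p × IsRun (B ∷ Bs) σ P
    extend ι→I t φ→F (P , refl , ts , ι→Is , φ→Fs) =
      p ∷ᶠ P , refl , ∀-cons t ts , ∀-cons ι→I ι→Is , ∀-cons φ→F φ→Fs

  accepts⇔path : ∀ D s → IsODD D → Accepts D s ⇔ (InΣ≤ (length D) s × ∃ λ p → Path p (pairs D (padAt s)))
  accepts⇔path D s (_ , _ , ini , fin) = mk⇔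
    (λ (1≤ , ≤k , P , t , I₀ , Fₖ) → (1≤ , ≤k) , P fzero ,
       to (isRun⇔path D (padAt s) (P fzero))
          (P , refl , t , (λ i → I₀ i ∘ to (ini i)) , λ i → Fₖ i ∘ to (fin i)))
    (λ ((1≤ , ≤k) , p , path) → let (P , _ , t , ι→I , φ→F) = from (isRun⇔path D (padAt s) p) path in
       1≤ , ≤k , P , t , (λ i → ι→I i ∘ from (ini i)) , λ i → φ→F i ∘ from (fin i))

-- Convolutions

applyUpTo-cong : {A : Set} {f g : ℕ → A} → (∀ j → f j ≡ g j) → ∀ m → applyUpTo f m ≡ applyUpTo g m
applyUpTo-cong f≗g zero    = refl
applyUpTo-cong f≗g (suc m) = cong₂ _∷_ (f≗g 0) (applyUpTo-cong (f≗g ∘ suc) m)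

maxLen-≤ : {B : Set} {c : ℕ} (ss : Vec (List B) c) {m : ℕ} →
           (∀ k → length (lookupᵛ ss k) ≤ m) → maxLen ss ≤ m
maxLen-≤ []ᵛ       ss≤m = z≤n
maxLen-≤ (s ∷ᵛ ss) ss≤m = ⊔-lub (ss≤m fzero) (maxLen-≤ ss (ss≤m ∘ fsuc))

module _ {A B : Set} {c : ℕ} where

  letter : List A → Vec (List B) c → ℕ → Maybe A × Vec (Maybe B) c
  letter D ss j = padAt D j , Vec.map (λ s → padAt s j) ss

  column : Fin c → List (Maybe A × Vec (Maybe B) c) → List (Maybe B)
  column k = map (λ x → lookupᵛ (proj₂ x) k)

  conv-bounded : ∀ D ss → (∀ k → length (lookupᵛ ss k) ≤ length D) →
                 conv D ss ≡ applyUpTo (letter D ss) (length D)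
  conv-bounded D ss ss≤D =
    trans (map-upTo (letter D ss) _) (cong (applyUpTo (letter D ss)) (m≥n⇒m⊔n≡m (maxLen-≤ ss ss≤D)))

  layers-letters : ∀ D ss m → map proj₁ (applyUpTo (letter D ss) m) ≡ pad D m
  layers-letters D ss m = map-applyUpTo (letter D ss) proj₁ m

  column-letters : ∀ D ss m k → column k (applyUpTo (letter D ss) m) ≡ pad (lookupᵛ ss k) m
  column-letters D ss m k = trans (map-applyUpTo (letter D ss) _ m) (applyUpTo-cong (λ j → lookup-map k _ ss) m)

  ≡applyUpTo-by-columns : ∀ u m (f : ℕ → Maybe A) (g : Fin c → ℕ → Maybe B) →
    map proj₁ u ≡ applyUpTo f m → (∀ k → column k u ≡ applyUpTo (g k) m) →
    u ≡ applyUpTo (λ j → f j , tabulate (λ k → g k j)) m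
  ≡applyUpTo-by-columns []             zero    f g _ _    = refl
  ≡applyUpTo-by-columns ((a , as) ∷ u) (suc m) f g e cols = cong₂ _∷_
    (cong₂ _,_ (∷-injectiveˡ e) (trans (sym (tabulate∘lookup as)) (tabulate-cong (∷-injectiveˡ ∘ cols))))
    (≡applyUpTo-by-columns u m (f ∘ suc) (λ k → g k ∘ suc) (∷-injectiveʳ e) (∷-injectiveʳ ∘ cols))

  conv-by-columns : ∀ u D (s : Fin c → List B) → map proj₁ u ≡ map just D →
    (∀ k → column k u ≡ pad (s k) (length D)) → (∀ k → length (s k) ≤ length D) → conv D (tabulate s) ≡ u
  conv-by-columns u D s layers cols s≤D = begin
    conv D (tabulate s)
      ≡⟨ conv-bounded D (tabulate s) bounded ⟩
    applyUpTo (letter D (tabulate s)) (length D)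
      ≡⟨ applyUpTo-cong (λ j → cong (padAt D j ,_) (sym (tabulate-∘ (λ t → padAt t j) s))) (length D) ⟩
    applyUpTo (λ j → padAt D j , tabulate (λ k → padAt (s k) j)) (length D)
      ≡⟨ sym (≡applyUpTo-by-columns u (length D) (padAt D) (padAt ∘ s) (trans layers (sym (pad-length D))) cols) ⟩
    u ∎
    where
    open ≡-Reasoning
    bounded : ∀ k → length (lookupᵛ (tabulate s) k) ≤ length D
    bounded k = subst (λ t → length t ≤ length D) (sym (lookup∘tabulate s k)) (s≤D k)

-- The recognizer

module Recognizer (n w c : ℕ) where

  Letter : Set
  Letter = Maybe (Layer n w) × Vec (Maybe (Fin n)) c

  track : Fin c → Letter → Track
  track k x = proj₁ x , lookupᵛ (proj₂ x) k

  shapeReader : Machine (Track {n} {w})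
  shapeReader = comap proj₂ paddingChecker

  stringReader : Machine (Track {n} {w})
  stringReader = shapeReader ⊗ reachability

  layersReader : Machine Letter
  layersReader = comap proj₁ oddChecker

  stringsReader : Machine Letter
  stringsReader = parallel c track stringReader

  recognizer : Machine Letter
  recognizer = layersReader ⊗ stringsReader

  Config : Set
  Config = State recognizer

  WellFormed : Config → Set
  WellFormed g = IsComplete (proj₁ g) × ∀ k → Accepting (proj₁ (lookupᵛ (proj₂ g) k))

  Reaches : Fin c → Config → Set
  Reaches k g = Nonempty (proj₂ (lookupᵛ (proj₂ g) k))

  wellFormed? : Decidable WellFormed
  wellFormed? g = isComplete? (proj₁ g) ×-dec all? (λ k → accepting? (proj₁ (lookupᵛ (proj₂ g) k)))

  reaches? : ∀ k → Decidable (Reaches k)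
  reaches? k g = nonempty? (proj₂ (lookupᵛ (proj₂ g) k))

  phase-exec : ∀ u → proj₁ (exec recognizer u) ≡ exec oddChecker (map proj₁ u)
  phase-exec u = trans (cong proj₁ (exec-⊗ layersReader stringsReader u)) (execFrom-comap proj₁ oddChecker initial u)

  string-exec : ∀ u k → lookupᵛ (proj₂ (exec recognizer u)) k ≡ exec stringReader (map (track k) u)
  string-exec u k = trans (cong (λ g → lookupᵛ (proj₂ g) k) (exec-⊗ layersReader stringsReader u))
                          (lookup-exec-parallel track stringReader u k)

  scan-exec : ∀ u k → proj₁ (lookupᵛ (proj₂ (exec recognizer u)) k) ≡ exec paddingChecker (column k u)
  scan-exec u k = begin
    proj₁ (lookupᵛ (proj₂ (exec recognizer u)) k)     ≡⟨ cong proj₁ (string-exec u k) ⟩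
    proj₁ (exec stringReader ts)                      ≡⟨ cong proj₁ (exec-⊗ shapeReader reachability ts) ⟩
    exec shapeReader ts                               ≡⟨ execFrom-comap proj₂ paddingChecker atStart ts ⟩
    exec paddingChecker (map proj₂ ts)                ≡⟨ cong (exec paddingChecker) (sym (map-∘ u)) ⟩
    exec paddingChecker (column k u)                  ∎
    where
    open ≡-Reasoning
    ts = map (track k) u

  reach-exec : ∀ u k → proj₂ (lookupᵛ (proj₂ (exec recognizer u)) k) ≡ exec reachability (map (track k) u)
  reach-exec u k = trans (cong proj₂ (string-exec u k)) (cong proj₂ (exec-⊗ shapeReader reachability (map (track k) u)))

  ConvImage : (List (Layer n w) → Vec (List (Fin n)) c → Set) → List Letter → Set
  ConvImage R u = ∃ λ D → ∃ λ ss → R D ss × conv D ss ≡ u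

  ConvImage-cong : ∀ {R R′} → (∀ D ss → R D ss ⇔ R′ D ss) → ∀ u → ConvImage R u ⇔ ConvImage R′ u
  ConvImage-cong R⇔R′ u = mk⇔ (λ (D , ss , r , e) → D , ss , to (R⇔R′ D ss) r , e)
                               (λ (D , ss , r , e) → D , ss , from (R⇔R′ D ss) r , e)

  wellFormed⇒R~ : ∀ u → WellFormed (exec recognizer u) → ConvImage (R~ n w c) u
  wellFormed⇒R~ u (done , accepting) =
    D , tabulate s , (from (isODD⇔completes D) cs , lookup⁻ inΣ) ,
    conv-by-columns u D s layers columns (proj₂ ∘ bounds)
    where
    completion = to (complete⇔completes initial (map proj₁ u)) (subst IsComplete (phase-exec u) done)
    D = proj₁ completion
    layers = proj₁ (proj₂ completion)
    cs = proj₂ (proj₂ completion)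
    column-length : ∀ k → length (column k u) ≡ length D
    column-length k = trans (length-map _ u) 
      (trans (sym (length-map proj₁ u)) (trans (cong length layers) (length-map just D)))
    padded : ∀ k → Padded (length D) (column k u)
    padded k = subst (λ m → Padded m (column k u)) (column-length k)
      (to (accepting⇔padded (column k u)) (subst Accepting (scan-exec u k) (accepting k)))
    s : Fin c → List (Fin n)
    s k = proj₁ (padded k)
    bounds : ∀ k → InΣ≤ (length D) (s k)
    bounds k = proj₁ (proj₂ (padded k))
    columns : ∀ k → column k u ≡ pad (s k) (length D)
    columns k = proj₂ (proj₂ (padded k))
    inΣ : ∀ k → InΣ≤ (length D) (lookupᵛ (tabulate s) k)
    inΣ k = subst (InΣ≤ (length D)) (sym (lookup∘tabulate s k)) (bounds k)

  R~⇒wellFormed : ∀ D ss → R~ n w c D ss → WellFormed (exec recognizer (conv D ss))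
  R~⇒wellFormed D ss (odd , ins) =
      subst IsComplete (sym (phase-exec (conv D ss)))
        (from (complete⇔completes initial _) (D , layers , to (isODD⇔completes D) odd))
    , λ k → subst Accepting (sym (scan-exec (conv D ss) k))
        (from (accepting⇔padded (column k (conv D ss)))
          (subst (λ m → Padded m (column k (conv D ss))) (sym (column-length k))
                 (lookupᵛ ss k , lookup⁺ ins k , columns k)))
    where
    letters = conv-bounded D ss (proj₂ ∘ lookup⁺ ins)
    layers : map proj₁ (conv D ss) ≡ map just D
    layers = trans (cong (map proj₁) letters) (trans (layers-letters D ss (length D)) (pad-length D))
    columns : ∀ k → column k (conv D ss) ≡ pad (lookupᵛ ss k) (length D)
    columns k = trans (cong (column k) letters) (column-letters D ss (length D) k)
    column-length : ∀ k → length (column k (conv D ss)) ≡ length D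
    column-length k = trans (cong length (columns k)) (length-applyUpTo _ (length D))

  wellFormed⇔R~ : ∀ u → WellFormed (exec recognizer u) ⇔ ConvImage (R~ n w c) u
  wellFormed⇔R~ u = mk⇔ (wellFormed⇒R~ u) λ { (D , ss , r~ , refl) → R~⇒wellFormed D ss r~ }

  tracks-conv : ∀ D ss → (∀ k → length (lookupᵛ ss k) ≤ length D) →
                ∀ k → map (track k) (conv D ss) ≡ pairs D (padAt (lookupᵛ ss k))
  tracks-conv D ss ss≤D k = begin
    map (track k) (conv D ss)                          ≡⟨ cong (map (track k)) (conv-bounded D ss ss≤D) ⟩
    map (track k) (applyUpTo (letter D ss) (length D)) ≡⟨ map-applyUpTo (letter D ss) (track k) (length D) ⟩
    applyUpTo (track k ∘ letter D ss) (length D)       ≡⟨ applyUpTo-cong track-letter (length D) ⟩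
    pairs D (padAt (lookupᵛ ss k))                     ∎
    where
    open ≡-Reasoning
    track-letter : ∀ j → track k (letter D ss j) ≡ (padAt D j , padAt (lookupᵛ ss k) j)
    track-letter j = cong (padAt D j ,_) (lookup-map k _ ss)

  reaches⇔accepts : ∀ D ss → R~ n w c D ss →
                    ∀ k → Reaches k (exec recognizer (conv D ss)) ⇔ Accepts D (lookupᵛ ss k)
  reaches⇔accepts D ss (odd , ins) k = mk⇔
    (λ reaches → let (p , _ , path) = to (nonempty⇔path full ys) (subst Nonempty reached reaches) in
       from (accepts⇔path D (lookupᵛ ss k) odd) (lookup⁺ ins k , p , path))
    (λ accepts → let (_ , p , path) = to (accepts⇔path D (lookupᵛ ss k) odd) accepts in
       subst Nonempty (sym reached) (from (nonempty⇔path full ys) (p , ∈⊤ , path)))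
    where
    ys = pairs D (padAt (lookupᵛ ss k))
    reached : proj₂ (lookupᵛ (proj₂ (exec recognizer (conv D ss))) k) ≡ exec reachability ys
    reached = trans (reach-exec (conv D ss) k) (cong (exec reachability) (tracks-conv D ss (proj₂ ∘ lookup⁺ ins) k))

  wellFormed×⇔ : {Q : Config → Set} {R : List (Layer n w) → Vec (List (Fin n)) c → Set} →
    (∀ D ss → R~ n w c D ss → Q (exec recognizer (conv D ss)) ⇔ R D ss) →
    ∀ u → (WellFormed (exec recognizer u) × Q (exec recognizer u)) ⇔ ConvImage (λ D ss → R~ n w c D ss × R D ss) u
  wellFormed×⇔ {Q} {R} Q⇔R u = mk⇔
    (λ (wf , q) → refined (wellFormed⇒R~ u wf) q)
    λ { (D , ss , (r~ , r) , refl) → R~⇒wellFormed D ss r~ , from (Q⇔R D ss r~) r }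
    where
    refined : ∀ {u} → ConvImage (R~ n w c) u → Q (exec recognizer u) → ConvImage (λ D ss → R~ n w c D ss × R D ss) u
    refined (D , ss , r~ , refl) q = D , ss , (r~ , to (Q⇔R D ss r~) q) , refl

  R∈⇔ : ∀ D ss → R∈ n w c D ss ⇔ (R~ n w c D ss × ∀ k → Accepts D (lookupᵛ ss k))
  R∈⇔ D ss = mk⇔
    (λ (odd , accs) → (odd , lookup⁻ (λ k → let (1≤ , ≤k , _) = lookup⁺ accs k in 1≤ , ≤k)) , lookup⁺ accs)
    (λ ((odd , _) , accs) → odd , lookup⁻ accs)

  R∉⇔ : ∀ D ss → R∉ n w c D ss ⇔ (R~ n w c D ss × ∃ λ k → ¬ Accepts D (lookupᵛ ss k))
  R∉⇔ D ss = mk⇔ (λ (odd , ins , rej) → (odd , ins) , rej) (λ ((odd , ins) , rej) → odd , ins , rej)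

  R~-regular : RegularRelation (R~ n w c)
  R~-regular = machine⇒regular recognizer wellFormed? wellFormed⇔R~

  R∈-regular : RegularRelation (R∈ n w c)
  R∈-regular = machine⇒regular recognizer (λ g → wellFormed? g ×-dec all? λ k → reaches? k g) λ u →
    ⇔-trans (wellFormed×⇔ {λ g → ∀ k → Reaches k g} (λ D ss r~ → Π-⇔ (reaches⇔accepts D ss r~)) u)
            (ConvImage-cong (λ D ss → ⇔-sym (R∈⇔ D ss)) u)

  R∉-regular : RegularRelation (R∉ n w c)
  R∉-regular = machine⇒regular recognizer (λ g → wellFormed? g ×-dec any? λ k → ¬? (reaches? k g)) λ u →
    ⇔-trans (wellFormed×⇔ {λ g → ∃ λ k → ¬ Reaches k g} (λ D ss r~ → ∃¬-⇔ (reaches⇔accepts D ss r~)) u)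
            (ConvImage-cong (λ D ss → ⇔-sym (R∉⇔ D ss)) u)

lemma1 : (n w c : ℕ) → 1 ≤ w → 1 ≤ c →
    RegularRelation (R∈ n w c) × RegularRelation (R~ n w c) × RegularRelation (R∉ n w c)
lemma1 n w c _ _ = R∈-regular , R~-regular , R∉-regular
  where open Recognizer n w c
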